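{- Let $d \geq 2$ be an integer, and let $u = \sum_{n \geq 0} C_d(n) x^n$. Then $u$ satisfies \[ u = (1+xu) \left( 1+xu (1+xu)^{d-2}\right), \] or equivalently, \[ u = \frac{1+xu}{1-x(1+xu)^{d-1}}. \]
   Context: For integers $d\ge 2$ and $n,k\ge 0$, $N_d(n,k) = \frac{1}{n+1} \binom{n+1}{k+1} \binom{ n + (n-k)(d-2)+1}{k}$, and $C_d(n) = \sum_{k=0}^n N_d(n,k)$. The power series are formal power series in $x$. -}

module Defs where

open import Data.Nat using (ℕ; zero; suc; _+_; _*_; _∸_; _/_)
open import Data.Nat.Combinatorics using (_C_)

-- Formal power series in x with natural-number coefficients,
-- represented by their coefficient sequence: f n = [x^n] f.
Series : Set
Series = ℕ → ℕ

sumTo : ℕ → (ℕ → ℕ) → ℕ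
sumTo zero    f = f 0
sumTo (suc n) f = sumTo n f + f (suc n)

𝟙 : Series
𝟙 zero    = 1
𝟙 (suc _) = 0

_⊕_ : Series → Series → Series
(f ⊕ g) n = f n + g n

_⊛_ : Series → Series → Series
(f ⊛ g) n = sumTo n (λ i → f i * g (n ∸ i))

X* : Series → Series
X* f zero    = 0
X* f (suc n) = f n

_^ˢ_ : Series → ℕ → Series
f ^ˢ zero  = 𝟙
f ^ˢ suc m = f ⊛ (f ^ˢ m)

-- N_d(n,k) = 1/(n+1) * binom(n+1,k+1) * binom(n + (n-k)(d-2) + 1, k)
-- (the product is always divisible by n+1, so ℕ-division is exact)
N : ℕ → ℕ → ℕ → ℕ
N d n k = ((suc n C suc k) * ((n + (n ∸ k) * (d ∸ 2) + 1) C k)) / suc n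

Cd : ℕ → ℕ → ℕ
Cd d n = sumTo n (N d n)

u : ℕ → Series
u d = Cd d

{-# OPTIONS --safe #-}
-- Put y = x·u and φ(t) = (1 + t)(1 + t(1 + t)^(d-2)); the first identity says y = x·φ(y).
-- Expanding φ^(n+1) binomially and absorbing the factor n + 1 into the binomial coefficients
-- gives [t^n] φ^(n+1) = (n + 1)·C_d(n), so y = x·φ(y) is an instance of Lagrange inversion.
-- Lagrange inversion holds over ℕ without division: by strong induction on m one shows
-- simultaneously m·[x^m] y^r = r·[t^(m-r)] φ^m and [x^m] u = [x^m] φ(y), with derivatives
-- replaced by the Euler operator θ = x d/dx, for which θ(φ^(r+1)) = (r + 1)·θφ·φ^r.
-- The second identity is the first with 1 + y(1 + y)^(d-2) multiplied out.
module Submission where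

open import Defs
open import Level using (0ℓ)
open import Algebra.Bundles using (CommutativeSemigroup)
open import Data.Nat
open import Data.Nat.Properties
open import Data.Nat.Combinatorics using (_C_; nCk+nC[k+1]≡[n+1]C[k+1]; nC1≡n; nCk≡nC[n∸k])
open import Data.Nat.Divisibility using (_∣_; ∣m+n∣m⇒∣n; m∣m*n)
open import Data.Nat.DivMod using (m*[n/m]≡n)
open import Data.Nat.Induction using (<-rec)
open import Data.Nat.Tactic.RingSolver using (solve-∀)
open import Data.Product using (_×_; _,_; proj₁; proj₂)
open import Data.Sum using (inj₁; inj₂)
open import Relation.Binary using (Setoid; IsEquivalence)
open import Relation.Binary.PropositionalEquality
import Relation.Binary.Reasoning.Setoid as SetoidReasoning
open import Algebra.Properties.CommutativeSemigroup +-commutativeSemigroup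
  using () renaming (interchange to +-interchange)
open import Algebra.Properties.CommutativeSemigroup *-commutativeSemigroup
  using () renaming (x∙yz≈y∙xz to m*[n*o]≡n*[m*o])

-- Finite sums

sumTo-cong-≤ : ∀ n {f g : ℕ → ℕ} → (∀ i → i ≤ n → f i ≡ g i) → sumTo n f ≡ sumTo n g
sumTo-cong-≤ zero    f≡g = f≡g 0 z≤n
sumTo-cong-≤ (suc n) f≡g =
  cong₂ _+_ (sumTo-cong-≤ n λ i i≤n → f≡g i (m≤n⇒m≤1+n i≤n)) (f≡g (suc n) ≤-refl)

sumTo-cong : ∀ n {f g : ℕ → ℕ} → (∀ i → f i ≡ g i) → sumTo n f ≡ sumTo n g
sumTo-cong n f≡g = sumTo-cong-≤ n λ i _ → f≡g i

sumTo-zero : ∀ n {f : ℕ → ℕ} → (∀ i → i ≤ n → f i ≡ 0) → sumTo n f ≡ 0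
sumTo-zero zero    f≡0 = f≡0 0 z≤n
sumTo-zero (suc n) f≡0 =
  cong₂ _+_ (sumTo-zero n λ i i≤n → f≡0 i (m≤n⇒m≤1+n i≤n)) (f≡0 (suc n) ≤-refl)

sumTo-distrib-+ : ∀ n (f g : ℕ → ℕ) → sumTo n (λ i → f i + g i) ≡ sumTo n f + sumTo n g
sumTo-distrib-+ zero    f g = refl
sumTo-distrib-+ (suc n) f g =
  trans (cong (_+ (f (suc n) + g (suc n))) (sumTo-distrib-+ n f g))
        (+-interchange (sumTo n f) (sumTo n g) (f (suc n)) (g (suc n)))

*-distribˡ-sumTo : ∀ c n (f : ℕ → ℕ) → c * sumTo n f ≡ sumTo n (λ i → c * f i)
*-distribˡ-sumTo c zero    f = refl
*-distribˡ-sumTo c (suc n) f =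
  trans (*-distribˡ-+ c (sumTo n f) (f (suc n))) (cong (_+ c * f (suc n)) (*-distribˡ-sumTo c n f))

sumTo-suc : ∀ n (f : ℕ → ℕ) → sumTo (suc n) f ≡ f 0 + sumTo n (λ i → f (suc i))
sumTo-suc zero    f = refl
sumTo-suc (suc n) f = trans (cong (_+ f (suc (suc n))) (sumTo-suc n f)) (+-assoc (f 0) _ _)

sumTo-comm : ∀ m n (f : ℕ → ℕ → ℕ) →
             sumTo m (λ i → sumTo n (f i)) ≡ sumTo n (λ j → sumTo m (λ i → f i j))
sumTo-comm zero    n f = refl
sumTo-comm (suc m) n f =
  trans (cong (_+ sumTo n (f (suc m))) (sumTo-comm m n f))
        (sym (sumTo-distrib-+ n (λ j → sumTo m (λ i → f i j)) (f (suc m))))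

sumTo-reverse : ∀ n (f : ℕ → ℕ) → sumTo n f ≡ sumTo n (λ i → f (n ∸ i))
sumTo-reverse zero    f = refl
sumTo-reverse (suc n) f = begin
  sumTo n f + f (suc n)                  ≡⟨ cong (_+ f (suc n)) (sumTo-reverse n f) ⟩
  sumTo n (λ i → f (n ∸ i)) + f (suc n)  ≡⟨ +-comm _ (f (suc n)) ⟩
  f (suc n) + sumTo n (λ i → f (n ∸ i))  ≡⟨ sumTo-suc n (λ i → f (suc n ∸ i)) ⟨
  sumTo (suc n) (λ i → f (suc n ∸ i))    ∎
  where open ≡-Reasoning

sumTo-truncate : ∀ {m} n (f : ℕ → ℕ) → m ≤ n → (∀ i → m < i → f i ≡ 0) → sumTo n f ≡ sumTo m f
sumTo-truncate zero    f z≤n    _   = refl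
sumTo-truncate (suc n) f m≤1+n f≡0 with m≤n⇒m<n∨m≡n m≤1+n
... | inj₂ refl  = refl
... | inj₁ m<1+n = trans (cong₂ _+_ (sumTo-truncate n f (≤-pred m<1+n) f≡0) (f≡0 (suc n) m<1+n))
                         (+-identityʳ _)

-- Formal power series

infix 4 _≈ˢ_
record _≈ˢ_ (f g : Series) : Set where
  constructor coeffwise
  field coeff : ∀ n → f n ≡ g n
open _≈ˢ_ public

≈ˢ-isEquivalence : IsEquivalence _≈ˢ_
≈ˢ-isEquivalence = record
  { refl  = coeffwise λ _ → refl
  ; sym   = λ f≈g → coeffwise λ n → sym (coeff f≈g n)
  ; trans = λ f≈g g≈h → coeffwise λ n → trans (coeff f≈g n) (coeff g≈h n)
  }

≈ˢ-setoid : Setoid 0ℓ 0ℓ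
≈ˢ-setoid = record { isEquivalence = ≈ˢ-isEquivalence }

open Setoid ≈ˢ-setoid public using () renaming (refl to ≈ˢ-refl; sym to ≈ˢ-sym; trans to ≈ˢ-trans)

module ≈ˢ-Reasoning = SetoidReasoning ≈ˢ-setoid

tail : Series → Series
tail f n = f (suc n)

𝕩 : Series
𝕩 = X* 𝟙

infixr 7 _·_
_·_ : ℕ → Series → Series
(c · f) n = c * f n

⊕-cong : ∀ {f f′ g g′} → f ≈ˢ f′ → g ≈ˢ g′ → f ⊕ g ≈ˢ f′ ⊕ g′
⊕-cong f≈f′ g≈g′ = coeffwise λ n → cong₂ _+_ (coeff f≈f′ n) (coeff g≈g′ n)

⊕-congˡ : ∀ f {g g′} → g ≈ˢ g′ → f ⊕ g ≈ˢ f ⊕ g′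
⊕-congˡ f = ⊕-cong (≈ˢ-refl {f})

⊛-cong : ∀ {f f′ g g′} → f ≈ˢ f′ → g ≈ˢ g′ → f ⊛ g ≈ˢ f′ ⊛ g′
⊛-cong f≈f′ g≈g′ = coeffwise λ n →
  sumTo-cong n λ i → cong₂ _*_ (coeff f≈f′ i) (coeff g≈g′ (n ∸ i))

⊛-congˡ : ∀ f {g g′} → g ≈ˢ g′ → f ⊛ g ≈ˢ f ⊛ g′
⊛-congˡ f = ⊛-cong (≈ˢ-refl {f})

⊛-congʳ : ∀ {f f′} g → f ≈ˢ f′ → f ⊛ g ≈ˢ f′ ⊛ g
⊛-congʳ g f≈f′ = ⊛-cong f≈f′ (≈ˢ-refl {g})

·-congˡ : ∀ c {f g} → f ≈ˢ g → c · f ≈ˢ c · g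
·-congˡ c f≈g = coeffwise λ n → cong (c *_) (coeff f≈g n)

X*-cong : ∀ {f g} → f ≈ˢ g → X* f ≈ˢ X* g
X*-cong f≈g = coeffwise λ { zero → refl ; (suc n) → coeff f≈g n }

⊛-suc : ∀ f g n → (f ⊛ g) (suc n) ≡ f 0 * g (suc n) + (tail f ⊛ g) n
⊛-suc f g n = sumTo-suc n _

tail-⊛ : ∀ f g → tail (f ⊛ g) ≈ˢ (f 0 · tail g) ⊕ (tail f ⊛ g)
tail-⊛ f g = coeffwise (⊛-suc f g)

⊛-comm : ∀ f g → f ⊛ g ≈ˢ g ⊛ f
⊛-comm f g = coeffwise λ n → trans (sumTo-reverse n _) (sumTo-cong-≤ n λ i i≤n →
  trans (cong (λ j → f (n ∸ i) * g j) (m∸[m∸n]≡n i≤n)) (*-comm (f (n ∸ i)) (g i)))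

⊛-distribʳ-⊕ : ∀ h f g → (f ⊕ g) ⊛ h ≈ˢ (f ⊛ h) ⊕ (g ⊛ h)
⊛-distribʳ-⊕ h f g = coeffwise λ n →
  trans (sumTo-cong n λ i → *-distribʳ-+ (h (n ∸ i)) (f i) (g i)) (sumTo-distrib-+ n _ _)

⊛-distribˡ-⊕ : ∀ h f g → h ⊛ (f ⊕ g) ≈ˢ (h ⊛ f) ⊕ (h ⊛ g)
⊛-distribˡ-⊕ h f g = coeffwise λ n →
  trans (sumTo-cong n λ i → *-distribˡ-+ (h i) (f (n ∸ i)) (g (n ∸ i))) (sumTo-distrib-+ n _ _)

·-⊛ : ∀ c f g → (c · f) ⊛ g ≈ˢ c · (f ⊛ g)
·-⊛ c f g = coeffwise λ n →
  trans (sumTo-cong n λ i → *-assoc c (f i) _) (sym (*-distribˡ-sumTo c n _))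

⊛-· : ∀ c f g → f ⊛ (c · g) ≈ˢ c · (f ⊛ g)
⊛-· c f g = coeffwise λ n →
  trans (sumTo-cong n λ i → m*[n*o]≡n*[m*o] (f i) c _) (sym (*-distribˡ-sumTo c n _))

⊛-assoc : ∀ f g h → (f ⊛ g) ⊛ h ≈ˢ f ⊛ (g ⊛ h)
⊛-assoc f g h = coeffwise (assoc-coeff f)
  where
  open ≡-Reasoning
  assoc-coeff : ∀ f n → ((f ⊛ g) ⊛ h) n ≡ (f ⊛ (g ⊛ h)) n
  assoc-coeff f zero    = *-assoc (f 0) (g 0) (h 0)
  assoc-coeff f (suc n) = begin
    ((f ⊛ g) ⊛ h) (suc n)
      ≡⟨ ⊛-suc (f ⊛ g) h n ⟩
    f 0 * g 0 * h (suc n) + (tail (f ⊛ g) ⊛ h) n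
      ≡⟨ cong (f 0 * g 0 * h (suc n) +_) (coeff (⊛-congʳ h (tail-⊛ f g)) n) ⟩
    f 0 * g 0 * h (suc n) + (((f 0 · tail g) ⊕ (tail f ⊛ g)) ⊛ h) n
      ≡⟨ cong (f 0 * g 0 * h (suc n) +_) (coeff (⊛-distribʳ-⊕ h (f 0 · tail g) (tail f ⊛ g)) n) ⟩
    f 0 * g 0 * h (suc n) + (((f 0 · tail g) ⊛ h) n + ((tail f ⊛ g) ⊛ h) n)
      ≡⟨ cong (f 0 * g 0 * h (suc n) +_)
              (cong₂ _+_ (coeff (·-⊛ (f 0) (tail g) h) n) (assoc-coeff (tail f) n)) ⟩
    f 0 * g 0 * h (suc n) + (f 0 * (tail g ⊛ h) n + (tail f ⊛ (g ⊛ h)) n)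
      ≡⟨ regroup (f 0) (g 0) (h (suc n)) _ _ ⟩
    f 0 * (g 0 * h (suc n) + (tail g ⊛ h) n) + (tail f ⊛ (g ⊛ h)) n
      ≡⟨ cong (λ c → f 0 * c + (tail f ⊛ (g ⊛ h)) n) (⊛-suc g h n) ⟨
    f 0 * (g ⊛ h) (suc n) + (tail f ⊛ (g ⊛ h)) n
      ≡⟨ ⊛-suc f (g ⊛ h) n ⟨
    (f ⊛ (g ⊛ h)) (suc n) ∎
    where
    regroup : ∀ a b c x y → a * b * c + (a * x + y) ≡ a * (b * c + x) + y
    regroup = solve-∀

⊛-commutativeSemigroup : CommutativeSemigroup 0ℓ 0ℓ
⊛-commutativeSemigroup = record
  { Carrier = Series
  ; _≈_     = _≈ˢ_
  ; _∙_     = _⊛_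
  ; isCommutativeSemigroup = record
    { isSemigroup = record
      { isMagma = record { isEquivalence = ≈ˢ-isEquivalence ; ∙-cong = ⊛-cong }
      ; assoc   = ⊛-assoc
      }
    ; comm = ⊛-comm
    }
  }

open import Algebra.Properties.CommutativeSemigroup ⊛-commutativeSemigroup
  using () renaming (interchange to ⊛-interchange; x∙yz≈y∙xz to f⊛[g⊛h]≈g⊛[f⊛h])

⊛-identityˡ : ∀ f → 𝟙 ⊛ f ≈ˢ f
⊛-identityˡ f = coeffwise λ
  { zero    → +-identityʳ (f 0)
  ; (suc n) → trans (⊛-suc 𝟙 f n)
                    (trans (cong₂ _+_ (*-identityˡ (f (suc n))) (sumTo-zero n λ _ _ → refl))
                           (+-identityʳ _))
  }

⊛-identityʳ : ∀ f → f ⊛ 𝟙 ≈ˢ f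
⊛-identityʳ f = ≈ˢ-trans (⊛-comm f 𝟙) (⊛-identityˡ f)

X*-⊛ : ∀ f g → X* f ⊛ g ≈ˢ X* (f ⊛ g)
X*-⊛ f g = coeffwise λ { zero → refl ; (suc n) → ⊛-suc (X* f) g n }

𝕩-⊛ : ∀ f → 𝕩 ⊛ f ≈ˢ X* f
𝕩-⊛ f = ≈ˢ-trans (X*-⊛ 𝟙 f) (X*-cong (⊛-identityˡ f))

^ˢ-cong : ∀ {f g} → f ≈ˢ g → ∀ m → f ^ˢ m ≈ˢ g ^ˢ m
^ˢ-cong f≈g zero    = ≈ˢ-refl
^ˢ-cong f≈g (suc m) = ⊛-cong f≈g (^ˢ-cong f≈g m)

^ˢ-distribˡ-+-⊛ : ∀ f a b → f ^ˢ (a + b) ≈ˢ (f ^ˢ a) ⊛ (f ^ˢ b)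
^ˢ-distribˡ-+-⊛ f zero    b = ≈ˢ-sym (⊛-identityˡ (f ^ˢ b))
^ˢ-distribˡ-+-⊛ f (suc a) b =
  ≈ˢ-trans (⊛-congˡ f (^ˢ-distribˡ-+-⊛ f a b)) (≈ˢ-sym (⊛-assoc f (f ^ˢ a) (f ^ˢ b)))

^ˢ-distribʳ-⊛ : ∀ f g m → (f ⊛ g) ^ˢ m ≈ˢ (f ^ˢ m) ⊛ (g ^ˢ m)
^ˢ-distribʳ-⊛ f g zero    = ≈ˢ-sym (⊛-identityˡ 𝟙)
^ˢ-distribʳ-⊛ f g (suc m) =
  ≈ˢ-trans (⊛-congˡ (f ⊛ g) (^ˢ-distribʳ-⊛ f g m)) (⊛-interchange f g (f ^ˢ m) (g ^ˢ m))

^ˢ-*-assoc : ∀ f a b → (f ^ˢ a) ^ˢ b ≈ˢ f ^ˢ (b * a)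
^ˢ-*-assoc f a zero    = ≈ˢ-refl
^ˢ-*-assoc f a (suc b) =
  ≈ˢ-trans (⊛-congˡ (f ^ˢ a) (^ˢ-*-assoc f a b)) (≈ˢ-sym (^ˢ-distribˡ-+-⊛ f a (b * a)))

𝕩^ˢ-⊛-coeff : ∀ j f k → ((𝕩 ^ˢ j) ⊛ f) (j + k) ≡ f k
𝕩^ˢ-⊛-coeff zero    f k = coeff (⊛-identityˡ f) k
𝕩^ˢ-⊛-coeff (suc j) f k =
  trans (coeff (≈ˢ-trans (⊛-assoc 𝕩 (𝕩 ^ˢ j) f) (𝕩-⊛ ((𝕩 ^ˢ j) ⊛ f))) (suc (j + k)))
        (𝕩^ˢ-⊛-coeff j f k)

infix 4 _≈ˢ[_]_
_≈ˢ[_]_ : Series → ℕ → Series → Set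
f ≈ˢ[ m ] g = ∀ k → k ≤ m → f k ≡ g k

≈ˢ[]-suc : ∀ {f g} m → f ≈ˢ[ m ] g → f (suc m) ≡ g (suc m) → f ≈ˢ[ suc m ] g
≈ˢ[]-suc m f≈g f≡g k k≤1+m with m≤n⇒m<n∨m≡n k≤1+m
... | inj₁ k<1+m = f≈g k (≤-pred k<1+m)
... | inj₂ refl  = f≡g

⊛-cong-≤ : ∀ {f f′ g g′} m → f ≈ˢ[ m ] f′ → g ≈ˢ[ m ] g′ → f ⊛ g ≈ˢ[ m ] f′ ⊛ g′
⊛-cong-≤ m f≈f′ g≈g′ k k≤m = sumTo-cong-≤ k λ i i≤k →
  cong₂ _*_ (f≈f′ i (≤-trans i≤k k≤m)) (g≈g′ (k ∸ i) (≤-trans (m∸n≤m k i) k≤m))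

^ˢ-cong-≤ : ∀ {f g} m → f ≈ˢ[ m ] g → ∀ r → f ^ˢ r ≈ˢ[ m ] g ^ˢ r
^ˢ-cong-≤ m f≈g zero    k _ = refl
^ˢ-cong-≤ m f≈g (suc r)     = ⊛-cong-≤ m f≈g (^ˢ-cong-≤ m f≈g r)

θ : Series → Series
θ f n = n * f n

θ-cong : ∀ {f g} → f ≈ˢ g → θ f ≈ˢ θ g
θ-cong f≈g = coeffwise λ n → cong (n *_) (coeff f≈g n)

θ-⊛ : ∀ f g → θ (f ⊛ g) ≈ˢ (θ f ⊛ g) ⊕ (f ⊛ θ g)
θ-⊛ f g = coeffwise λ n → begin
  n * sumTo n (λ i → f i * g (n ∸ i))
    ≡⟨ *-distribˡ-sumTo n n _ ⟩
  sumTo n (λ i → n * (f i * g (n ∸ i)))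
    ≡⟨ sumTo-cong-≤ n (λ i i≤n →
         trans (cong (λ m → m * (f i * g (n ∸ i))) (sym (m+[n∸m]≡n i≤n)))
               (leibniz i (n ∸ i) (f i) (g (n ∸ i)))) ⟩
  sumTo n (λ i → i * f i * g (n ∸ i) + f i * ((n ∸ i) * g (n ∸ i)))
    ≡⟨ sumTo-distrib-+ n _ _ ⟩
  (θ f ⊛ g) n + (f ⊛ θ g) n ∎
  where
  open ≡-Reasoning
  leibniz : ∀ i j a b → (i + j) * (a * b) ≡ i * a * b + a * (j * b)
  leibniz = solve-∀

θ-^ˢ : ∀ f r → θ (f ^ˢ suc r) ≈ˢ suc r · (θ f ⊛ (f ^ˢ r))
θ-^ˢ f zero = begin
  θ (f ⊛ 𝟙)      ≈⟨ θ-cong (⊛-identityʳ f) ⟩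
  θ f            ≈⟨ ⊛-identityʳ (θ f) ⟨
  θ f ⊛ 𝟙        ≈⟨ coeffwise (λ n → sym (*-identityˡ _)) ⟩
  1 · (θ f ⊛ 𝟙)  ∎
  where open ≈ˢ-Reasoning
θ-^ˢ f (suc r) = begin
  θ (f ⊛ (f ^ˢ suc r))
    ≈⟨ θ-⊛ f (f ^ˢ suc r) ⟩
  (θ f ⊛ (f ^ˢ suc r)) ⊕ (f ⊛ θ (f ^ˢ suc r))
    ≈⟨ ⊕-congˡ (θ f ⊛ (f ^ˢ suc r)) (⊛-congˡ f (θ-^ˢ f r)) ⟩
  (θ f ⊛ (f ^ˢ suc r)) ⊕ (f ⊛ (suc r · (θ f ⊛ (f ^ˢ r))))
    ≈⟨ ⊕-congˡ (θ f ⊛ (f ^ˢ suc r)) (⊛-· (suc r) f (θ f ⊛ (f ^ˢ r))) ⟩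
  (θ f ⊛ (f ^ˢ suc r)) ⊕ (suc r · (f ⊛ (θ f ⊛ (f ^ˢ r))))
    ≈⟨ ⊕-congˡ (θ f ⊛ (f ^ˢ suc r)) (·-congˡ (suc r) (f⊛[g⊛h]≈g⊛[f⊛h] f (θ f) (f ^ˢ r))) ⟩
  (θ f ⊛ (f ^ˢ suc r)) ⊕ (suc r · (θ f ⊛ (f ^ˢ suc r)))
    ≡⟨⟩
  suc (suc r) · (θ f ⊛ (f ^ˢ suc r)) ∎
  where open ≈ˢ-Reasoning

θ-^ˢ-⊛-^ˢ : ∀ f r t → θ (f ^ˢ suc r) ⊛ (f ^ˢ t) ≈ˢ suc r · (θ f ⊛ (f ^ˢ (r + t)))
θ-^ˢ-⊛-^ˢ f r t = begin
  θ (f ^ˢ suc r) ⊛ (f ^ˢ t)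
    ≈⟨ ⊛-congʳ (f ^ˢ t) (θ-^ˢ f r) ⟩
  (suc r · (θ f ⊛ (f ^ˢ r))) ⊛ (f ^ˢ t)
    ≈⟨ ·-⊛ (suc r) (θ f ⊛ (f ^ˢ r)) (f ^ˢ t) ⟩
  suc r · ((θ f ⊛ (f ^ˢ r)) ⊛ (f ^ˢ t))
    ≈⟨ ·-congˡ (suc r) (⊛-assoc (θ f) (f ^ˢ r) (f ^ˢ t)) ⟩
  suc r · (θ f ⊛ ((f ^ˢ r) ⊛ (f ^ˢ t)))
    ≈⟨ ·-congˡ (suc r) (⊛-congˡ (θ f) (^ˢ-distribˡ-+-⊛ f r t)) ⟨
  suc r · (θ f ⊛ (f ^ˢ (r + t))) ∎
  where open ≈ˢ-Reasoning

-- Composition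

-- The composition P(y), summed only up to j = n: this is faithful only when y 0 ≡ 0,
-- which makes [x^n] y^j vanish for j > n.
infixr 9 _∘ˢ_
_∘ˢ_ : Series → Series → Series
(P ∘ˢ y) n = sumTo n (λ j → P j * (y ^ˢ j) n)

∘ˢ-congʳ : ∀ {P Q} y → P ≈ˢ Q → P ∘ˢ y ≈ˢ Q ∘ˢ y
∘ˢ-congʳ y P≈Q = coeffwise λ n → sumTo-cong n λ j → cong (_* (y ^ˢ j) n) (coeff P≈Q j)

∘ˢ-distribʳ-⊕ : ∀ P Q y → (P ⊕ Q) ∘ˢ y ≈ˢ (P ∘ˢ y) ⊕ (Q ∘ˢ y)
∘ˢ-distribʳ-⊕ P Q y = coeffwise λ n →
  trans (sumTo-cong n λ j → *-distribʳ-+ ((y ^ˢ j) n) (P j) (Q j)) (sumTo-distrib-+ n _ _)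

·-∘ˢ : ∀ c P y → (c · P) ∘ˢ y ≈ˢ c · (P ∘ˢ y)
·-∘ˢ c P y = coeffwise λ n →
  trans (sumTo-cong n λ j → *-assoc c (P j) ((y ^ˢ j) n)) (sym (*-distribˡ-sumTo c n _))

module Composition (y : Series) (y₀≡0 : y 0 ≡ 0) where

  ^ˢ-coeff-below : ∀ j k → k < j → (y ^ˢ j) k ≡ 0
  ^ˢ-coeff-below (suc j) zero    _         = cong (_* (y ^ˢ j) 0) y₀≡0
  ^ˢ-coeff-below (suc j) (suc k) (s≤s k<j) = trans (⊛-suc y (y ^ˢ j) k) (cong₂ _+_
    (cong (_* (y ^ˢ j) (suc k)) y₀≡0)
    (sumTo-zero k λ i _ → trans (cong (y (suc i) *_)
                                      (^ˢ-coeff-below j (k ∸ i) (≤-<-trans (m∸n≤m k i) k<j)))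
                                (*-zeroʳ (y (suc i)))))

  private
    vanishing : ∀ (P : Series) j k → k < j → P j * (y ^ˢ j) k ≡ 0
    vanishing P j k k<j = trans (cong (P j *_) (^ˢ-coeff-below j k k<j)) (*-zeroʳ (P j))

  ⊛-∘ˢ-coeff : ∀ A P n → (A ⊛ (P ∘ˢ y)) n ≡ sumTo n (λ j → P j * (A ⊛ (y ^ˢ j)) n)
  ⊛-∘ˢ-coeff A P n = begin
    sumTo n (λ i → A i * sumTo (n ∸ i) (λ j → P j * (y ^ˢ j) (n ∸ i)))
      ≡⟨ sumTo-cong n (λ i → cong (A i *_)
           (sym (sumTo-truncate n _ (m∸n≤m n i) λ j → vanishing P j (n ∸ i)))) ⟩
    sumTo n (λ i → A i * sumTo n (λ j → P j * (y ^ˢ j) (n ∸ i)))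
      ≡⟨ sumTo-cong n (λ i → *-distribˡ-sumTo (A i) n _) ⟩
    sumTo n (λ i → sumTo n (λ j → A i * (P j * (y ^ˢ j) (n ∸ i))))
      ≡⟨ sumTo-comm n n _ ⟩
    sumTo n (λ j → sumTo n (λ i → A i * (P j * (y ^ˢ j) (n ∸ i))))
      ≡⟨ sumTo-cong n (λ j → trans (sumTo-cong n λ i → m*[n*o]≡n*[m*o] (A i) (P j) _)
                                   (sym (*-distribˡ-sumTo (P j) n _))) ⟩
    sumTo n (λ j → P j * (A ⊛ (y ^ˢ j)) n) ∎
    where open ≡-Reasoning

  ∘ˢ-suc : ∀ P n → (P ∘ˢ y) (suc n) ≡ (y ⊛ (tail P ∘ˢ y)) (suc n)
  ∘ˢ-suc P n = begin
    (P ∘ˢ y) (suc n)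
      ≡⟨ sumTo-suc n _ ⟩
    P 0 * 0 + sumTo n (λ j → P (suc j) * (y ^ˢ suc j) (suc n))
      ≡⟨ cong (_+ sumTo n (λ j → P (suc j) * (y ^ˢ suc j) (suc n))) (*-zeroʳ (P 0)) ⟩
    sumTo n (λ j → P (suc j) * (y ^ˢ suc j) (suc n))
      ≡⟨ sumTo-truncate (suc n) _ (n≤1+n n) (λ j n<j → vanishing P (suc j) (suc n) (s≤s n<j)) ⟨
    sumTo (suc n) (λ j → P (suc j) * (y ^ˢ suc j) (suc n))
      ≡⟨ ⊛-∘ˢ-coeff y (tail P) (suc n) ⟨
    (y ⊛ (tail P ∘ˢ y)) (suc n) ∎
    where open ≡-Reasoning

  ∘ˢ-unfold : ∀ P → P ∘ˢ y ≈ˢ (P 0 · 𝟙) ⊕ (y ⊛ (tail P ∘ˢ y))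
  ∘ˢ-unfold P = coeffwise λ
    { zero    → sym (trans (cong (λ c → P 0 * 1 + c * (tail P ∘ˢ y) 0) y₀≡0) (+-identityʳ _))
    ; (suc n) → trans (∘ˢ-suc P n) (cong (_+ (y ⊛ (tail P ∘ˢ y)) (suc n)) (sym (*-zeroʳ (P 0))))
    }

  ∘ˢ-𝟙 : 𝟙 ∘ˢ y ≈ˢ 𝟙
  ∘ˢ-𝟙 = coeffwise λ
    { zero    → refl
    ; (suc n) → trans (sumTo-suc n _) (sumTo-zero n λ _ _ → refl)
    }

  ∘ˢ-𝕩 : 𝕩 ∘ˢ y ≈ˢ y
  ∘ˢ-𝕩 = coeffwise λ
    { zero    → sym y₀≡0
    ; (suc n) → trans (∘ˢ-suc 𝕩 n) (coeff (≈ˢ-trans (⊛-congˡ y ∘ˢ-𝟙) (⊛-identityʳ y)) (suc n))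
    }

  𝟙⊕𝕩-∘ˢ : (𝟙 ⊕ 𝕩) ∘ˢ y ≈ˢ 𝟙 ⊕ y
  𝟙⊕𝕩-∘ˢ = ≈ˢ-trans (∘ˢ-distribʳ-⊕ 𝟙 𝕩 y) (⊕-cong ∘ˢ-𝟙 ∘ˢ-𝕩)

  y⊛-cong-≤ : ∀ {F G} n → F ≈ˢ[ n ] G → (y ⊛ F) (suc n) ≡ (y ⊛ G) (suc n)
  y⊛-cong-≤ {F} {G} n F≈G = begin
    (y ⊛ F) (suc n)                  ≡⟨ ⊛-suc y F n ⟩
    y 0 * F (suc n) + (tail y ⊛ F) n  ≡⟨ cong (λ c → c * F (suc n) + (tail y ⊛ F) n) y₀≡0 ⟩
    (tail y ⊛ F) n                   ≡⟨ ⊛-cong-≤ {tail y} {tail y} n (λ _ _ → refl) F≈G n ≤-refl ⟩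
    (tail y ⊛ G) n                   ≡⟨ cong (λ c → c * G (suc n) + (tail y ⊛ G) n) y₀≡0 ⟨
    y 0 * G (suc n) + (tail y ⊛ G) n  ≡⟨ ⊛-suc y G n ⟨
    (y ⊛ G) (suc n)                  ∎
    where open ≡-Reasoning

  ∘ˢ-⊛-≤ : ∀ n P Q → (P ⊛ Q) ∘ˢ y ≈ˢ[ n ] (P ∘ˢ y) ⊛ (Q ∘ˢ y)
  ∘ˢ-⊛-≤ zero    P Q .0 z≤n =
    trans (*-identityʳ (P 0 * Q 0)) (sym (cong₂ _*_ (*-identityʳ (P 0)) (*-identityʳ (Q 0))))
  ∘ˢ-⊛-≤ (suc n) P Q = ≈ˢ[]-suc n (∘ˢ-⊛-≤ n P Q) (begin
    ((P ⊛ Q) ∘ˢ y) (suc n)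
      ≡⟨ ∘ˢ-suc (P ⊛ Q) n ⟩
    (y ⊛ (tail (P ⊛ Q) ∘ˢ y)) (suc n)
      ≡⟨ y⊛-cong-≤ n tail-≤ ⟩
    (y ⊛ ((P 0 · (tail Q ∘ˢ y)) ⊕ ((tail P ∘ˢ y) ⊛ (Q ∘ˢ y)))) (suc n)
      ≡⟨ coeff expand (suc n) ⟩
    P 0 * (y ⊛ (tail Q ∘ˢ y)) (suc n) + ((y ⊛ (tail P ∘ˢ y)) ⊛ (Q ∘ˢ y)) (suc n)
      ≡⟨ cong (λ c → P 0 * c + ((y ⊛ (tail P ∘ˢ y)) ⊛ (Q ∘ˢ y)) (suc n)) (∘ˢ-suc Q n) ⟨
    P 0 * (Q ∘ˢ y) (suc n) + ((y ⊛ (tail P ∘ˢ y)) ⊛ (Q ∘ˢ y)) (suc n)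
      ≡⟨ coeff unfold (suc n) ⟨
    ((P ∘ˢ y) ⊛ (Q ∘ˢ y)) (suc n) ∎)
    where
    open ≡-Reasoning
    linear : tail (P ⊛ Q) ∘ˢ y ≈ˢ (P 0 · (tail Q ∘ˢ y)) ⊕ ((tail P ⊛ Q) ∘ˢ y)
    linear = ≈ˢ-trans (∘ˢ-congʳ y (tail-⊛ P Q))
             (≈ˢ-trans (∘ˢ-distribʳ-⊕ (P 0 · tail Q) (tail P ⊛ Q) y)
                       (⊕-cong (·-∘ˢ (P 0) (tail Q) y) ≈ˢ-refl))
    tail-≤ : tail (P ⊛ Q) ∘ˢ y ≈ˢ[ n ] (P 0 · (tail Q ∘ˢ y)) ⊕ ((tail P ∘ˢ y) ⊛ (Q ∘ˢ y))
    tail-≤ k k≤n =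
      trans (coeff linear k) (cong (P 0 * (tail Q ∘ˢ y) k +_) (∘ˢ-⊛-≤ n (tail P) Q k k≤n))
    expand : y ⊛ ((P 0 · (tail Q ∘ˢ y)) ⊕ ((tail P ∘ˢ y) ⊛ (Q ∘ˢ y)))
             ≈ˢ (P 0 · (y ⊛ (tail Q ∘ˢ y))) ⊕ ((y ⊛ (tail P ∘ˢ y)) ⊛ (Q ∘ˢ y))
    expand = ≈ˢ-trans (⊛-distribˡ-⊕ y (P 0 · (tail Q ∘ˢ y)) ((tail P ∘ˢ y) ⊛ (Q ∘ˢ y)))
                      (⊕-cong (⊛-· (P 0) y (tail Q ∘ˢ y)) (≈ˢ-sym (⊛-assoc y (tail P ∘ˢ y) (Q ∘ˢ y))))
    unfold : (P ∘ˢ y) ⊛ (Q ∘ˢ y) ≈ˢ (P 0 · (Q ∘ˢ y)) ⊕ ((y ⊛ (tail P ∘ˢ y)) ⊛ (Q ∘ˢ y))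
    unfold = ≈ˢ-trans (⊛-congʳ (Q ∘ˢ y) (∘ˢ-unfold P))
             (≈ˢ-trans (⊛-distribʳ-⊕ (Q ∘ˢ y) (P 0 · 𝟙) (y ⊛ (tail P ∘ˢ y)))
                       (⊕-cong (≈ˢ-trans (·-⊛ (P 0) 𝟙 (Q ∘ˢ y))
                                         (·-congˡ (P 0) (⊛-identityˡ (Q ∘ˢ y))))
                               ≈ˢ-refl))

  ∘ˢ-⊛ : ∀ P Q → (P ⊛ Q) ∘ˢ y ≈ˢ (P ∘ˢ y) ⊛ (Q ∘ˢ y)
  ∘ˢ-⊛ P Q = coeffwise λ n → ∘ˢ-⊛-≤ n P Q n ≤-refl

  ∘ˢ-^ˢ : ∀ P r → (P ^ˢ r) ∘ˢ y ≈ˢ (P ∘ˢ y) ^ˢ r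
  ∘ˢ-^ˢ P zero    = ∘ˢ-𝟙
  ∘ˢ-^ˢ P (suc r) = ≈ˢ-trans (∘ˢ-⊛ P (P ^ˢ r)) (⊛-congˡ (P ∘ˢ y) (∘ˢ-^ˢ P r))

-- Lagrange inversion

module LagrangeInversion (φ v : Series) (φ-powers : ∀ n → (φ ^ˢ suc n) n ≡ suc n * v n) where

  private
    y : Series
    y = X* v

  open Composition y refl

  PowerCoeffs : ℕ → Set
  PowerCoeffs m = ∀ r t → r + t ≡ m → m * (y ^ˢ r) m ≡ r * (φ ^ˢ m) t

  FixedAt : ℕ → Set
  FixedAt n = v n ≡ (φ ∘ˢ y) n

  θ-∘ˢ-coeff : ∀ R n → PowerCoeffs n → n * (R ∘ˢ y) n ≡ (θ R ⊛ (φ ^ˢ n)) n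
  θ-∘ˢ-coeff R n powers = begin
    n * sumTo n (λ j → R j * (y ^ˢ j) n)           ≡⟨ *-distribˡ-sumTo n n _ ⟩
    sumTo n (λ j → n * (R j * (y ^ˢ j) n))         ≡⟨ sumTo-cong-≤ n (λ j j≤n →
      trans (m*[n*o]≡n*[m*o] n (R j) _)
      (trans (cong (R j *_) (powers j (n ∸ j) (m+[n∸m]≡n j≤n)))
      (trans (m*[n*o]≡n*[m*o] (R j) j _) (sym (*-assoc j (R j) _))))) ⟩
    sumTo n (λ j → j * R j * (φ ^ˢ n) (n ∸ j))     ∎
    where open ≡-Reasoning

  fixedAt : ∀ n → PowerCoeffs n → FixedAt n
  fixedAt zero      _      = sym (trans (φ-powers 0) (+-identityʳ (v 0)))
  fixedAt n@(suc _) powers = *-cancelˡ-≡ _ _ (suc n) (*-cancelˡ-≡ _ _ n (begin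
    n * (suc n * v n)            ≡⟨ cong (n *_) (φ-powers n) ⟨
    n * (φ ^ˢ suc n) n           ≡⟨ coeff (θ-^ˢ φ n) n ⟩
    suc n * (θ φ ⊛ (φ ^ˢ n)) n   ≡⟨ cong (suc n *_) (θ-∘ˢ-coeff φ n powers) ⟨
    suc n * (n * (φ ∘ˢ y) n)     ≡⟨ m*[n*o]≡n*[m*o] (suc n) n ((φ ∘ˢ y) n) ⟩
    n * (suc n * (φ ∘ˢ y) n)     ∎))
    where open ≡-Reasoning

  ^ˢ-coeff-shift : ∀ {m} r t → r + t ≡ m → (∀ {k} → k < m → FixedAt k) →
                   (y ^ˢ r) m ≡ ((φ ^ˢ r) ∘ˢ y) t
  ^ˢ-coeff-shift r t refl fixed = begin
    (y ^ˢ r) (r + t)                      ≡⟨ ^ˢ-cong-≤ (r + t) y≈x[φ∘y] r (r + t) ≤-refl ⟩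
    (X* (φ ∘ˢ y) ^ˢ r) (r + t)            ≡⟨ coeff (^ˢ-cong (𝕩-⊛ (φ ∘ˢ y)) r) (r + t) ⟨
    ((𝕩 ⊛ (φ ∘ˢ y)) ^ˢ r) (r + t)         ≡⟨ coeff (^ˢ-distribʳ-⊛ 𝕩 (φ ∘ˢ y) r) (r + t) ⟩
    ((𝕩 ^ˢ r) ⊛ ((φ ∘ˢ y) ^ˢ r)) (r + t)  ≡⟨ 𝕩^ˢ-⊛-coeff r ((φ ∘ˢ y) ^ˢ r) t ⟩
    ((φ ∘ˢ y) ^ˢ r) t                     ≡⟨ coeff (∘ˢ-^ˢ φ r) t ⟨
    ((φ ^ˢ r) ∘ˢ y) t                     ∎
    where
    open ≡-Reasoning
    y≈x[φ∘y] : y ≈ˢ[ r + t ] X* (φ ∘ˢ y)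
    y≈x[φ∘y] zero    _     = refl
    y≈x[φ∘y] (suc k) k<r+t = fixed k<r+t

  powerCoeffs : ∀ m → (∀ {k} → k < m → PowerCoeffs k × FixedAt k) → PowerCoeffs m
  powerCoeffs _ _  zero    zero    refl = refl
  powerCoeffs _ _  zero    (suc t) refl = *-zeroʳ (suc t)
  powerCoeffs m ih (suc r) zero    r+0≡m with refl ← trans (sym (+-identityʳ (suc r))) r+0≡m =
    cong (suc r *_) (trans (^ˢ-coeff-shift (suc r) 0 r+0≡m (λ k<m → proj₂ (ih k<m))) (*-identityʳ _))
  -- Multiplied by t, both sides become θ-coefficients of powers of φ, related by θ-^ˢ.
  powerCoeffs _ ih r@(suc r′) t@(suc _) refl = *-cancelˡ-≡ _ _ t (begin
    t * (m * (y ^ˢ r) m)                 ≡⟨ m*[n*o]≡n*[m*o] t m _ ⟩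
    m * (t * (y ^ˢ r) m)                 ≡⟨ cong (λ c → m * (t * c)) (^ˢ-coeff-shift r t refl fixed) ⟩
    m * (t * ((φ ^ˢ r) ∘ˢ y) t)          ≡⟨ cong (m *_) (θ-∘ˢ-coeff (φ ^ˢ r) t (proj₁ (ih t<m))) ⟩
    m * (θ (φ ^ˢ r) ⊛ (φ ^ˢ t)) t        ≡⟨ cong (m *_) (coeff (θ-^ˢ-⊛-^ˢ φ r′ t) t) ⟩
    m * (r * (θ φ ⊛ (φ ^ˢ (r′ + t))) t)  ≡⟨ m*[n*o]≡n*[m*o] m r _ ⟩
    r * (m * (θ φ ⊛ (φ ^ˢ (r′ + t))) t)  ≡⟨ cong (r *_) (coeff (θ-^ˢ φ (r′ + t)) t) ⟨
    r * (t * (φ ^ˢ m) t)                 ≡⟨ m*[n*o]≡n*[m*o] r t _ ⟩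
    t * (r * (φ ^ˢ m) t)                 ∎)
    where
    open ≡-Reasoning
    m : ℕ
    m = r + t
    t<m : t < m
    t<m = s≤s (m≤n+m t r′)
    fixed : ∀ {k} → k < m → FixedAt k
    fixed k<m = proj₂ (ih k<m)

  powerCoeffs×fixedAt : ∀ m → PowerCoeffs m × FixedAt m
  powerCoeffs×fixedAt = <-rec _ λ m ih → let powers = powerCoeffs m ih in powers , fixedAt m powers

lagrange-inversion : ∀ φ v → (∀ n → (φ ^ˢ suc n) n ≡ suc n * v n) → v ≈ˢ φ ∘ˢ X* v
lagrange-inversion φ v φ-powers = coeffwise λ n → proj₂ (powerCoeffs×fixedAt n)
  where open LagrangeInversion φ v φ-powers

-- Binomial coefficients

𝟙⊕𝕩-⊛ : ∀ f → (𝟙 ⊕ 𝕩) ⊛ f ≈ˢ f ⊕ X* f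
𝟙⊕𝕩-⊛ f = ≈ˢ-trans (⊛-distribʳ-⊕ f 𝟙 𝕩) (⊕-cong (⊛-identityˡ f) (𝕩-⊛ f))

binomial : ∀ a j → ((𝟙 ⊕ 𝕩) ^ˢ a) j ≡ a C j
binomial zero    zero    = refl
binomial zero    (suc j) = refl
binomial (suc a) zero    =
  trans (coeff (𝟙⊕𝕩-⊛ ((𝟙 ⊕ 𝕩) ^ˢ a)) 0) (trans (+-identityʳ _) (binomial a 0))
binomial (suc a) (suc j) = trans (coeff (𝟙⊕𝕩-⊛ ((𝟙 ⊕ 𝕩) ^ˢ a)) (suc j))
  (trans (cong₂ _+_ (binomial a (suc j)) (binomial a j))
         (trans (+-comm (a C suc j) (a C j)) (nCk+nC[k+1]≡[n+1]C[k+1] a j)))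

[1+k]*[1+n]C[1+k]≡[1+n]*nCk : ∀ n k → suc k * (suc n C suc k) ≡ suc n * (n C k)
[1+k]*[1+n]C[1+k]≡[1+n]*nCk zero    zero    = refl
[1+k]*[1+n]C[1+k]≡[1+n]*nCk zero    (suc k) = *-zeroʳ (suc (suc k))
[1+k]*[1+n]C[1+k]≡[1+n]*nCk (suc n) zero    =
  trans (+-identityʳ _) (trans (nC1≡n (suc (suc n))) (sym (*-identityʳ (suc (suc n)))))
[1+k]*[1+n]C[1+k]≡[1+n]*nCk (suc n) (suc k) = begin
  suc (suc k) * (suc (suc n) C suc (suc k))
    ≡⟨ cong (suc (suc k) *_) (nCk+nC[k+1]≡[n+1]C[k+1] (suc n) (suc k)) ⟨
  suc (suc k) * (suc n C suc k + suc n C suc (suc k))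
    ≡⟨ *-distribˡ-+ (suc (suc k)) (suc n C suc k) (suc n C suc (suc k)) ⟩
  suc n C suc k + suc k * (suc n C suc k) + suc (suc k) * (suc n C suc (suc k))
    ≡⟨ cong₂ (λ a b → suc n C suc k + a + b)
             ([1+k]*[1+n]C[1+k]≡[1+n]*nCk n k) ([1+k]*[1+n]C[1+k]≡[1+n]*nCk n (suc k)) ⟩
  suc n C suc k + suc n * (n C k) + suc n * (n C suc k)
    ≡⟨ +-assoc (suc n C suc k) _ _ ⟩
  suc n C suc k + (suc n * (n C k) + suc n * (n C suc k))
    ≡⟨ cong (suc n C suc k +_) (*-distribˡ-+ (suc n) (n C k) (n C suc k)) ⟨
  suc n C suc k + suc n * (n C k + n C suc k)
    ≡⟨ cong (λ c → suc n C suc k + suc n * c) (nCk+nC[k+1]≡[n+1]C[k+1] n k) ⟩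
  suc (suc n) * (suc n C suc k) ∎
  where open ≡-Reasoning

-- With M = n + (n ∸ k)e + 1 one has (M + 1) + (k + 1)e = (n + 1)(e + 1) + 1, so absorbing
-- k + 1 and M + 1 into the two binomials of the numerator P shows (n + 1) ∣ P·((n + 1)(e + 1) + 1).
[1+n]∣numerator : ∀ e n k → k ≤ n → suc n ∣ (suc n C suc k) * ((n + (n ∸ k) * e + 1) C k)
[1+n]∣numerator e n k k≤n =
  ∣m+n∣m⇒∣n (subst (suc n ∣_) multiple (m∣m*n (B + A * e))) (m∣m*n (suc e * P))
  where
  open ≡-Reasoning
  M P A B : ℕ
  M = n + (n ∸ k) * e + 1
  P = (suc n C suc k) * (M C k)
  A = (n C k) * (M C k)
  B = (n C k) * (suc M C suc k)

  [1+k]P : suc k * P ≡ suc n * A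
  [1+k]P = trans (sym (*-assoc (suc k) (suc n C suc k) (M C k)))
           (trans (cong (_* (M C k)) ([1+k]*[1+n]C[1+k]≡[1+n]*nCk n k))
                  (*-assoc (suc n) (n C k) (M C k)))

  [1+M]P : suc M * P ≡ suc n * B
  [1+M]P = begin
    suc M * ((suc n C suc k) * (M C k))
      ≡⟨ m*[n*o]≡n*[m*o] (suc M) (suc n C suc k) (M C k) ⟩
    (suc n C suc k) * (suc M * (M C k))
      ≡⟨ cong ((suc n C suc k) *_) ([1+k]*[1+n]C[1+k]≡[1+n]*nCk M k) ⟨
    (suc n C suc k) * (suc k * (suc M C suc k))
      ≡⟨ m*[n*o]≡n*[m*o] (suc n C suc k) (suc k) (suc M C suc k) ⟩
    suc k * ((suc n C suc k) * (suc M C suc k))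
      ≡⟨ *-assoc (suc k) (suc n C suc k) (suc M C suc k) ⟨
    suc k * (suc n C suc k) * (suc M C suc k)
      ≡⟨ cong (_* (suc M C suc k)) ([1+k]*[1+n]C[1+k]≡[1+n]*nCk n k) ⟩
    suc n * (n C k) * (suc M C suc k)
      ≡⟨ *-assoc (suc n) (n C k) (suc M C suc k) ⟩
    suc n * B ∎

  degree : suc M + suc k * e ≡ suc n * suc e + 1
  degree = subst (λ n′ → suc (n′ + (n ∸ k) * e + 1) + suc k * e ≡ suc n′ * suc e + 1)
                 (m+[n∸m]≡n k≤n) (identity k (n ∸ k) e)
    where
    identity : ∀ k t e → suc (k + t + t * e + 1) + suc k * e ≡ suc (k + t) * suc e + 1
    identity = solve-∀

  multiple : suc n * (B + A * e) ≡ suc n * (suc e * P) + P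
  multiple = begin
    suc n * (B + A * e)               ≡⟨ *-distribˡ-+ (suc n) B (A * e) ⟩
    suc n * B + suc n * (A * e)       ≡⟨ cong₂ _+_ (sym [1+M]P) (sym (*-assoc (suc n) A e)) ⟩
    suc M * P + suc n * A * e         ≡⟨ cong (λ c → suc M * P + c * e) (sym [1+k]P) ⟩
    suc M * P + suc k * P * e         ≡⟨ collect (suc M) (suc k) e P ⟩
    (suc M + suc k * e) * P           ≡⟨ cong (_* P) degree ⟩
    (suc n * suc e + 1) * P           ≡⟨ expand (suc n) (suc e) P ⟩
    suc n * (suc e * P) + P           ∎
    where
    collect : ∀ a b e p → a * p + b * p * e ≡ (a + b * e) * p
    collect = solve-∀
    expand : ∀ a b p → (a * b + 1) * p ≡ a * (b * p) + p
    expand = solve-∀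

[1+n]*N≡numerator : ∀ d n k → k ≤ n →
                    suc n * N d n k ≡ (suc n C suc k) * ((n + (n ∸ k) * (d ∸ 2) + 1) C k)
[1+n]*N≡numerator d n k k≤n = m*[n/m]≡n ([1+n]∣numerator (d ∸ 2) n k k≤n)

-- The series φ

φ : ℕ → Series
φ e = (𝟙 ⊕ 𝕩) ⊛ (𝟙 ⊕ (𝕩 ⊛ ((𝟙 ⊕ 𝕩) ^ˢ e)))

φ-∘ˢ : ∀ e y → y 0 ≡ 0 → φ e ∘ˢ y ≈ˢ (𝟙 ⊕ y) ⊛ (𝟙 ⊕ (y ⊛ ((𝟙 ⊕ y) ^ˢ e)))
φ-∘ˢ e y y₀≡0 = begin
  φ e ∘ˢ y
    ≈⟨ ∘ˢ-⊛ (𝟙 ⊕ 𝕩) (𝟙 ⊕ (𝕩 ⊛ ((𝟙 ⊕ 𝕩) ^ˢ e))) ⟩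
  ((𝟙 ⊕ 𝕩) ∘ˢ y) ⊛ ((𝟙 ⊕ (𝕩 ⊛ ((𝟙 ⊕ 𝕩) ^ˢ e))) ∘ˢ y)
    ≈⟨ ⊛-cong 𝟙⊕𝕩-∘ˢ (∘ˢ-distribʳ-⊕ 𝟙 (𝕩 ⊛ ((𝟙 ⊕ 𝕩) ^ˢ e)) y) ⟩
  (𝟙 ⊕ y) ⊛ ((𝟙 ∘ˢ y) ⊕ ((𝕩 ⊛ ((𝟙 ⊕ 𝕩) ^ˢ e)) ∘ˢ y))
    ≈⟨ ⊛-congˡ (𝟙 ⊕ y) (⊕-cong ∘ˢ-𝟙 (∘ˢ-⊛ 𝕩 ((𝟙 ⊕ 𝕩) ^ˢ e))) ⟩
  (𝟙 ⊕ y) ⊛ (𝟙 ⊕ ((𝕩 ∘ˢ y) ⊛ (((𝟙 ⊕ 𝕩) ^ˢ e) ∘ˢ y)))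
    ≈⟨ ⊛-congˡ (𝟙 ⊕ y) (⊕-congˡ 𝟙 (⊛-cong ∘ˢ-𝕩 (∘ˢ-^ˢ (𝟙 ⊕ 𝕩) e))) ⟩
  (𝟙 ⊕ y) ⊛ (𝟙 ⊕ (y ⊛ (((𝟙 ⊕ 𝕩) ∘ˢ y) ^ˢ e)))
    ≈⟨ ⊛-congˡ (𝟙 ⊕ y) (⊕-congˡ 𝟙 (⊛-congˡ y (^ˢ-cong 𝟙⊕𝕩-∘ˢ e))) ⟩
  (𝟙 ⊕ y) ⊛ (𝟙 ⊕ (y ⊛ ((𝟙 ⊕ y) ^ˢ e))) ∎
  where
  open ≈ˢ-Reasoning
  open Composition y y₀≡0

binomial-power-shift : ∀ e m j → ((𝟙 ⊕ 𝕩) ^ˢ m) ⊛ ((𝕩 ⊛ ((𝟙 ⊕ 𝕩) ^ˢ e)) ^ˢ j)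
                                   ≈ˢ (𝕩 ^ˢ j) ⊛ ((𝟙 ⊕ 𝕩) ^ˢ (m + j * e))
binomial-power-shift e m j = begin
  ((𝟙 ⊕ 𝕩) ^ˢ m) ⊛ ((𝕩 ⊛ ((𝟙 ⊕ 𝕩) ^ˢ e)) ^ˢ j)
    ≈⟨ ⊛-congˡ ((𝟙 ⊕ 𝕩) ^ˢ m) (^ˢ-distribʳ-⊛ 𝕩 ((𝟙 ⊕ 𝕩) ^ˢ e) j) ⟩
  ((𝟙 ⊕ 𝕩) ^ˢ m) ⊛ ((𝕩 ^ˢ j) ⊛ (((𝟙 ⊕ 𝕩) ^ˢ e) ^ˢ j))
    ≈⟨ ⊛-congˡ ((𝟙 ⊕ 𝕩) ^ˢ m) (⊛-congˡ (𝕩 ^ˢ j) (^ˢ-*-assoc (𝟙 ⊕ 𝕩) e j)) ⟩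
  ((𝟙 ⊕ 𝕩) ^ˢ m) ⊛ ((𝕩 ^ˢ j) ⊛ ((𝟙 ⊕ 𝕩) ^ˢ (j * e)))
    ≈⟨ f⊛[g⊛h]≈g⊛[f⊛h] ((𝟙 ⊕ 𝕩) ^ˢ m) (𝕩 ^ˢ j) ((𝟙 ⊕ 𝕩) ^ˢ (j * e)) ⟩
  (𝕩 ^ˢ j) ⊛ (((𝟙 ⊕ 𝕩) ^ˢ m) ⊛ ((𝟙 ⊕ 𝕩) ^ˢ (j * e)))
    ≈⟨ ⊛-congˡ (𝕩 ^ˢ j) (^ˢ-distribˡ-+-⊛ (𝟙 ⊕ 𝕩) m (j * e)) ⟨
  (𝕩 ^ˢ j) ⊛ ((𝟙 ⊕ 𝕩) ^ˢ (m + j * e)) ∎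
  where open ≈ˢ-Reasoning

φ^ˢ-coeff : ∀ e m n → (φ e ^ˢ m) n ≡ sumTo n (λ j → (m C j) * ((m + j * e) C (n ∸ j)))
φ^ˢ-coeff e m n = begin
  (φ e ^ˢ m) n
    ≡⟨ coeff (^ˢ-distribʳ-⊛ (𝟙 ⊕ 𝕩) (𝟙 ⊕ g) m) n ⟩
  (((𝟙 ⊕ 𝕩) ^ˢ m) ⊛ ((𝟙 ⊕ g) ^ˢ m)) n
    ≡⟨ coeff (⊛-congˡ ((𝟙 ⊕ 𝕩) ^ˢ m) binomial-theorem) n ⟩
  (((𝟙 ⊕ 𝕩) ^ˢ m) ⊛ (((𝟙 ⊕ 𝕩) ^ˢ m) ∘ˢ g)) n
    ≡⟨ ⊛-∘ˢ-coeff ((𝟙 ⊕ 𝕩) ^ˢ m) ((𝟙 ⊕ 𝕩) ^ˢ m) n ⟩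
  sumTo n (λ j → ((𝟙 ⊕ 𝕩) ^ˢ m) j * (((𝟙 ⊕ 𝕩) ^ˢ m) ⊛ (g ^ˢ j)) n)
    ≡⟨ sumTo-cong-≤ n (λ j j≤n → cong₂ _*_ (binomial m j) (shifted-binomial j j≤n)) ⟩
  sumTo n (λ j → (m C j) * ((m + j * e) C (n ∸ j))) ∎
  where
  open ≡-Reasoning
  g : Series
  g = 𝕩 ⊛ ((𝟙 ⊕ 𝕩) ^ˢ e)
  open Composition g refl

  binomial-theorem : (𝟙 ⊕ g) ^ˢ m ≈ˢ ((𝟙 ⊕ 𝕩) ^ˢ m) ∘ˢ g
  binomial-theorem = ≈ˢ-sym (≈ˢ-trans (∘ˢ-^ˢ (𝟙 ⊕ 𝕩) m) (^ˢ-cong 𝟙⊕𝕩-∘ˢ m))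

  shifted-binomial : ∀ j → j ≤ n → (((𝟙 ⊕ 𝕩) ^ˢ m) ⊛ (g ^ˢ j)) n ≡ (m + j * e) C (n ∸ j)
  shifted-binomial j j≤n = begin
    (((𝟙 ⊕ 𝕩) ^ˢ m) ⊛ (g ^ˢ j)) n  ≡⟨ coeff (binomial-power-shift e m j) n ⟩
    ((𝕩 ^ˢ j) ⊛ W) n              ≡⟨ cong ((𝕩 ^ˢ j) ⊛ W) (m+[n∸m]≡n j≤n) ⟨
    ((𝕩 ^ˢ j) ⊛ W) (j + (n ∸ j))  ≡⟨ 𝕩^ˢ-⊛-coeff j W (n ∸ j) ⟩
    W (n ∸ j)                     ≡⟨ binomial (m + j * e) (n ∸ j) ⟩
    (m + j * e) C (n ∸ j)         ∎
    where
    W : Series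
    W = (𝟙 ⊕ 𝕩) ^ˢ (m + j * e)

φ^ˢ⁺¹-coeff : ∀ d n → (φ (d ∸ 2) ^ˢ suc n) n ≡ suc n * Cd d n
φ^ˢ⁺¹-coeff d n = begin
  (φ e ^ˢ suc n) n
    ≡⟨ φ^ˢ-coeff e (suc n) n ⟩
  sumTo n (λ j → (suc n C j) * ((suc n + j * e) C (n ∸ j)))
    ≡⟨ sumTo-reverse n _ ⟩
  sumTo n (λ k → (suc n C (n ∸ k)) * ((suc n + (n ∸ k) * e) C (n ∸ (n ∸ k))))
    ≡⟨ sumTo-cong-≤ n (λ k k≤n → cong₂ _*_ (symmetry k k≤n)
         (cong₂ _C_ (+-comm 1 (n + (n ∸ k) * e)) (m∸[m∸n]≡n k≤n))) ⟩
  sumTo n (λ k → (suc n C suc k) * ((n + (n ∸ k) * e + 1) C k))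
    ≡⟨ sumTo-cong-≤ n (λ k k≤n → [1+n]*N≡numerator d n k k≤n) ⟨
  sumTo n (λ k → suc n * N d n k)
    ≡⟨ *-distribˡ-sumTo (suc n) n (N d n) ⟨
  suc n * Cd d n ∎
  where
  open ≡-Reasoning
  e : ℕ
  e = d ∸ 2
  symmetry : ∀ k → k ≤ n → suc n C (n ∸ k) ≡ suc n C suc k
  symmetry k k≤n = trans (nCk≡nC[n∸k] (≤-trans (m∸n≤m n k) (n≤1+n n)))
    (cong (suc n C_) (trans (+-∸-assoc 1 (m∸n≤m n k)) (cong suc (m∸[m∸n]≡n k≤n))))

V⊛[𝟙⊕xw⊛Vᵉ]≈V⊕xVᵉ⁺¹⊛w : ∀ V w e →
                          V ⊛ (𝟙 ⊕ (X* w ⊛ (V ^ˢ e))) ≈ˢ V ⊕ (X* (V ^ˢ suc e) ⊛ w)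
V⊛[𝟙⊕xw⊛Vᵉ]≈V⊕xVᵉ⁺¹⊛w V w e = begin
  V ⊛ (𝟙 ⊕ (X* w ⊛ (V ^ˢ e)))
    ≈⟨ ⊛-distribˡ-⊕ V 𝟙 (X* w ⊛ (V ^ˢ e)) ⟩
  (V ⊛ 𝟙) ⊕ (V ⊛ (X* w ⊛ (V ^ˢ e)))
    ≈⟨ ⊕-cong (⊛-identityʳ V) (f⊛[g⊛h]≈g⊛[f⊛h] V (X* w) (V ^ˢ e)) ⟩
  V ⊕ (X* w ⊛ (V ^ˢ suc e))
    ≈⟨ ⊕-congˡ V (X*-⊛ w (V ^ˢ suc e)) ⟩
  V ⊕ X* (w ⊛ (V ^ˢ suc e))
    ≈⟨ ⊕-congˡ V (X*-cong (⊛-comm w (V ^ˢ suc e))) ⟩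
  V ⊕ X* ((V ^ˢ suc e) ⊛ w)
    ≈⟨ ⊕-congˡ V (X*-⊛ (V ^ˢ suc e) w) ⟨
  V ⊕ (X* (V ^ˢ suc e) ⊛ w) ∎
  where open ≈ˢ-Reasoning

corollary2p3 : (d : ℕ) → 2 ≤ d →
    ((n : ℕ) → u d n ≡ ((𝟙 ⊕ X* (u d)) ⊛ (𝟙 ⊕ (X* (u d) ⊛ ((𝟙 ⊕ X* (u d)) ^ˢ (d ∸ 2))))) n)
    × ((n : ℕ) → u d n ≡ ((𝟙 ⊕ X* (u d)) ⊕ (X* ((𝟙 ⊕ X* (u d)) ^ˢ (d ∸ 1)) ⊛ u d)) n)
corollary2p3 d@(suc (suc e)) (s≤s (s≤s z≤n)) = first-form , second-form
  where
  y : Series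
  y = X* (u d)

  first-form : ∀ n → u d n ≡ ((𝟙 ⊕ y) ⊛ (𝟙 ⊕ (y ⊛ ((𝟙 ⊕ y) ^ˢ e)))) n
  first-form = coeff (≈ˢ-trans (lagrange-inversion (φ e) (u d) (φ^ˢ⁺¹-coeff d)) (φ-∘ˢ e y refl))

  second-form : ∀ n → u d n ≡ ((𝟙 ⊕ y) ⊕ (X* ((𝟙 ⊕ y) ^ˢ suc e) ⊛ u d)) n
  second-form n = trans (first-form n) (coeff (V⊛[𝟙⊕xw⊛Vᵉ]≈V⊕xVᵉ⁺¹⊛w (𝟙 ⊕ y) (u d) e) n)
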